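{- Let $r\geq 2$ be an integer and $0<a<\frac{1}{r(r+1)}$. Let $X$ be a finite set of cardinality $n$ and $A_{1},\dots,A_{r+1}$ subsets of $X$ with \[ \sum_{i=1}^{r+1}|A_{i}|\geq\left(r-\frac{1}{r}-(r+1)a\right)n. \] Then there exist $1\le k<l\le r+1$ such that \[ |A_{k}\cap A_{l}|\geq\left(\frac{r-2}{r}+\frac{2}{r^{2}(r+1)}-\frac{2(r-1)}{r}a\right)n. \]
   Formalization: The parameter a ranges over the rationals with 0 < a < 1/(r(r+1)). -}

module Defs where

open import Data.Nat as ℕ using (ℕ; zero; suc)
open import Data.Integer using (+_)
open import Data.Rational using (ℚ; 0ℚ; _/_)

-- reciprocal of a natural number as a rational; convention recip 0 = 0
-- (only ever applied to positive arguments in the statement)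
recip : ℕ → ℚ
recip zero = 0ℚ
recip (suc k) = (+ 1) / suc k

⟦_⟧ : ℕ → ℚ
⟦ m ⟧ = (+ m) / 1

module Submission where

-- Let d(x) be the number of sets containing the point x and m = r - 1. Double counting gives
-- Σ_k |A_k| = Σ_x d(x) and Σ_{k,l} |A_k ∩ A_l| = Σ_x d(x)². As (d - m)(d - m - 1) ≥ 0 for every
-- integer d, we get (2m + 1) d(x) ≤ d(x)² + m(m + 1), and summing over x,
-- (2m + 1) Σ_k |A_k| ≤ Σ_{k,l} |A_k ∩ A_l| + m(m + 1) n. The r(r + 1) off-diagonal terms on the
-- right are at most the largest pairwise intersection |A_k ∩ A_l|, and the diagonal terms sum to
-- Σ_k |A_k|, so 2(r - 1) Σ_k |A_k| ≤ r(r + 1) |A_k ∩ A_l| + r(r - 1) n.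

open import Defs

module Counting where
  open import Data.Bool using (Bool; true; false; _∧_)
  open import Data.Nat using (ℕ; zero; suc; _+_; _*_; _≤_; z≤n)
  open import Data.Nat.Properties
  open import Data.Nat.Tactic.RingSolver using (solve-∀)
  open import Data.Fin as Fin using (Fin; punchIn)
  import Data.Fin.Properties as Fin
  open import Data.Fin.Subset using (Subset; ∣_∣; _∩_)
  open import Data.Fin.Subset.Properties using (∩-comm; ∩-idem)
  open import Data.Vec as Vec using ([]; _∷_; lookup; tabulate)
  open import Data.Vec.Properties using (lookup-zipWith)
  open import Data.Sum using (inj₁; inj₂)
  open import Data.Product using (∃; ∃₂; _×_; _,_; proj₁; proj₂)
  open import Function using (_∘_)
  open import Relation.Binary using (tri<; tri≈; tri>)
  open import Relation.Binary.PropositionalEquality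
  open import Relation.Nullary using (contradiction)
  open import Algebra.Properties.Semiring.Sum +-*-semiring
    using (sum; sum-syntax; sum-cong-≗; sum-remove; ∑-comm; ∑-distrib-+; *-distribˡ-sum; *-distribʳ-sum)

  sum-tabulate : ∀ {n} (f : Fin n → ℕ) → Vec.sum (tabulate f) ≡ sum f
  sum-tabulate {zero} f = refl
  sum-tabulate {suc n} f = cong (f Fin.zero +_) (sum-tabulate (f ∘ Fin.suc))

  ∑-mono-≤ : ∀ {n} {f g : Fin n → ℕ} → (∀ i → f i ≤ g i) → sum f ≤ sum g
  ∑-mono-≤ {zero} f≤g = z≤n
  ∑-mono-≤ {suc n} f≤g = +-mono-≤ (f≤g Fin.zero) (∑-mono-≤ (f≤g ∘ Fin.suc))

  ∑-const : ∀ n c → ∑[ i < n ] c ≡ n * c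
  ∑-const zero c = refl
  ∑-const (suc n) c = cong (c +_) (∑-const n c)

  argmax : ∀ {n} (f : Fin (suc n) → ℕ) → ∃ λ i → ∀ j → f j ≤ f i
  argmax {zero} f = Fin.zero , λ { Fin.zero → ≤-refl }
  argmax {suc n} f with argmax (f ∘ Fin.suc)
  ... | i , i-max with ≤-total (f Fin.zero) (f (Fin.suc i))
  ...   | inj₁ f₀≤fᵢ = Fin.suc i , λ { Fin.zero → f₀≤fᵢ ; (Fin.suc j) → i-max j }
  ...   | inj₂ fᵢ≤f₀ = Fin.zero , λ { Fin.zero → ≤-refl ; (Fin.suc j) → ≤-trans (i-max j) fᵢ≤f₀ }

  argmax₂ : ∀ {m n} (f : Fin (suc m) → Fin (suc n) → ℕ) → ∃₂ λ i j → ∀ i′ j′ → f i′ j′ ≤ f i j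
  argmax₂ {m} {n} f = i , j i , λ i′ j′ → ≤-trans (j-max i′ j′) (i-max i′)
    where
    j : Fin (suc m) → Fin (suc n)
    j i = proj₁ (argmax (f i))
    j-max : ∀ i j′ → f i j′ ≤ f i (j i)
    j-max i = proj₂ (argmax (f i))
    i : Fin (suc m)
    i = proj₁ (argmax (λ i → f i (j i)))
    i-max : ∀ i′ → f i′ (j i′) ≤ f i (j i)
    i-max = proj₂ (argmax (λ i → f i (j i)))

  indicator : Bool → ℕ
  indicator false = 0
  indicator true  = 1

  indicator-∧ : ∀ b c → indicator (b ∧ c) ≡ indicator b * indicator c
  indicator-∧ false c = refl
  indicator-∧ true  c = sym (+-identityʳ (indicator c))

  χ : ∀ {n} → Subset n → Fin n → ℕ
  χ p x = indicator (lookup p x)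

  ∣p∣≡∑χ : ∀ {n} (p : Subset n) → ∣ p ∣ ≡ sum (χ p)
  ∣p∣≡∑χ []          = refl
  ∣p∣≡∑χ (false ∷ p) = ∣p∣≡∑χ p
  ∣p∣≡∑χ (true ∷ p)  = cong suc (∣p∣≡∑χ p)

  ∣p∩q∣≡∑χχ : ∀ {n} (p q : Subset n) → ∣ p ∩ q ∣ ≡ ∑[ x < n ] (χ p x * χ q x)
  ∣p∩q∣≡∑χχ p q = trans (∣p∣≡∑χ (p ∩ q))
    (sum-cong-≗ λ x → trans (cong indicator (lookup-zipWith _∧_ x p q)) (indicator-∧ (lookup p x) (lookup q x)))

  degree : ∀ {N n} → (Fin N → Subset n) → Fin n → ℕ
  degree {N} A x = ∑[ k < N ] χ (A k) x

  ∑∣A∣≡∑degree : ∀ {N n} (A : Fin N → Subset n) → ∑[ k < N ] ∣ A k ∣ ≡ sum (degree A)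
  ∑∣A∣≡∑degree A = trans (sum-cong-≗ (∣p∣≡∑χ ∘ A)) (∑-comm (χ ∘ A))

  ∑∣A∩A∣≡∑degree² : ∀ {N n} (A : Fin N → Subset n) →
    ∑[ k < N ] ∑[ l < N ] ∣ A k ∩ A l ∣ ≡ ∑[ x < n ] (degree A x * degree A x)
  ∑∣A∩A∣≡∑degree² {N} {n} A = begin
    ∑[ k < N ] ∑[ l < N ] ∣ A k ∩ A l ∣                ≡⟨ sum-cong-≗ (λ k → sum-cong-≗ (λ l → ∣p∩q∣≡∑χχ (A k) (A l))) ⟩
    ∑[ k < N ] ∑[ l < N ] ∑[ x < n ] (χ (A k) x * χ (A l) x)  ≡⟨ sum-cong-≗ (λ k → ∑-comm (λ l x → χ (A k) x * χ (A l) x)) ⟩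
    ∑[ k < N ] ∑[ x < n ] ∑[ l < N ] (χ (A k) x * χ (A l) x)  ≡⟨ ∑-comm (λ k x → ∑[ l < N ] (χ (A k) x * χ (A l) x)) ⟩
    ∑[ x < n ] ∑[ k < N ] ∑[ l < N ] (χ (A k) x * χ (A l) x)  ≡⟨ sum-cong-≗ (λ x → sum-cong-≗ (λ k → *-distribˡ-sum (χ (A k) x) (λ l → χ (A l) x))) ⟨
    ∑[ x < n ] ∑[ k < N ] (χ (A k) x * degree A x)            ≡⟨ sum-cong-≗ (λ x → *-distribʳ-sum (degree A x) (λ k → χ (A k) x)) ⟨
    ∑[ x < n ] (degree A x * degree A x)                      ∎
    where open ≡-Reasoning

  -- d² + m(m+1) - (2m+1)d = (d - m)(d - m - 1) is invariant under (m , d) ↦ (m + 1 , d + 1).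
  [1+2m]d≤d²+m[1+m] : ∀ m d → (1 + 2 * m) * d ≤ d * d + m * suc m
  [1+2m]d≤d²+m[1+m] m       zero    = subst (_≤ m * suc m) (sym (*-zeroʳ (1 + 2 * m))) z≤n
  [1+2m]d≤d²+m[1+m] zero    (suc d) = +-monoˡ-≤ 0 (m≤m*n (suc d) (suc d))
  [1+2m]d≤d²+m[1+m] (suc m) (suc d) = subst₂ _≤_ (shift-left m d) (shift-right m d) (+-monoˡ-≤ (2 * d + 2 * m + 3) ([1+2m]d≤d²+m[1+m] m d))
    where
    shift-left : ∀ m d → (1 + 2 * m) * d + (2 * d + 2 * m + 3) ≡ (1 + 2 * suc m) * suc d
    shift-left = solve-∀
    shift-right : ∀ m d → d * d + m * suc m + (2 * d + 2 * m + 3) ≡ suc d * suc d + suc m * suc (suc m)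
    shift-right = solve-∀

  double-counting-bound : ∀ m {N n} (A : Fin N → Subset n) →
    (1 + 2 * m) * ∑[ k < N ] ∣ A k ∣ ≤ ∑[ k < N ] ∑[ l < N ] ∣ A k ∩ A l ∣ + n * (m * suc m)
  double-counting-bound m {N} {n} A = begin
    (1 + 2 * m) * ∑[ k < N ] ∣ A k ∣                        ≡⟨ cong ((1 + 2 * m) *_) (∑∣A∣≡∑degree A) ⟩
    (1 + 2 * m) * sum (degree A)                            ≡⟨ *-distribˡ-sum (1 + 2 * m) (degree A) ⟩
    ∑[ x < n ] ((1 + 2 * m) * degree A x)                   ≤⟨ ∑-mono-≤ (λ x → [1+2m]d≤d²+m[1+m] m (degree A x)) ⟩
    ∑[ x < n ] (degree A x * degree A x + m * suc m)        ≡⟨ ∑-distrib-+ (λ x → degree A x * degree A x) (λ _ → m * suc m) ⟩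
    ∑[ x < n ] (degree A x * degree A x) + ∑[ x < n ] (m * suc m)
                                                            ≡⟨ cong₂ _+_ (∑∣A∩A∣≡∑degree² A) (sym (∑-const n (m * suc m))) ⟨
    ∑[ k < N ] ∑[ l < N ] ∣ A k ∩ A l ∣ + n * (m * suc m)   ∎
    where open ≤-Reasoning

  ∑∑≤∑diagonal : ∀ {N} (g : Fin (suc N) → Fin (suc N) → ℕ) {M} → (∀ k i → g k (punchIn k i) ≤ M) →
    ∑[ k < suc N ] ∑[ l < suc N ] g k l ≤ ∑[ k < suc N ] g k k + suc N * (N * M)
  ∑∑≤∑diagonal {N} g {M} off-diagonal≤M = begin
    ∑[ k < suc N ] ∑[ l < suc N ] g k l                      ≡⟨ sum-cong-≗ (λ k → sum-remove {i = k} (g k)) ⟩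
    ∑[ k < suc N ] (g k k + ∑[ i < N ] g k (punchIn k i))    ≤⟨ ∑-mono-≤ (λ k → +-monoʳ-≤ (g k k) (∑-mono-≤ (off-diagonal≤M k))) ⟩
    ∑[ k < suc N ] (g k k + ∑[ i < N ] M)                    ≡⟨ ∑-distrib-+ (λ k → g k k) (λ _ → ∑[ i < N ] M) ⟩
    ∑[ k < suc N ] g k k + ∑[ k < suc N ] ∑[ i < N ] M       ≡⟨ cong (∑[ k < suc N ] g k k +_) (trans (∑-const (suc N) _) (cong (suc N *_) (∑-const N M))) ⟩
    ∑[ k < suc N ] g k k + suc N * (N * M)                   ∎
    where open ≤-Reasoning

  maximal-off-diagonal-entry : ∀ {N} (g : Fin (2 + N) → Fin (2 + N) → ℕ) → (∀ k l → g k l ≡ g l k) →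
    ∃₂ λ k l → k Fin.< l × ∀ k′ i → g k′ (punchIn k′ i) ≤ g k l
  maximal-off-diagonal-entry g g-symmetric with argmax₂ (λ k i → g k (punchIn k i))
  ... | k , i , maximal with Fin.<-cmp k (punchIn k i)
  ...   | tri< k<l _ _ = k , punchIn k i , k<l , maximal
  ...   | tri> _ _ l<k = punchIn k i , k , l<k , λ k′ i′ → subst (g k′ (punchIn k′ i′) ≤_) (g-symmetric k (punchIn k i)) (maximal k′ i′)
  ...   | tri≈ _ k≡l _ = contradiction (sym k≡l) (Fin.punchInᵢ≢i k i)

  pair-with-large-intersection : ∀ m {N n} (A : Fin (2 + N) → Subset n) → ∃₂ λ k l → k Fin.< l ×
    2 * m * Vec.sum (tabulate (λ k → ∣ A k ∣)) ≤ (2 + N) * ((1 + N) * ∣ A k ∩ A l ∣) + n * (m * suc m)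
  pair-with-large-intersection m {N} {n} A
    with maximal-off-diagonal-entry (λ k l → ∣ A k ∩ A l ∣) (λ k l → cong ∣_∣ (∩-comm (A k) (A l)))
  ... | k , l , k<l , maximal = k , l , k<l , +-cancelˡ-≤ S′ _ _ (begin
    S′ + 2 * m * S′                                    ≡⟨ cong (λ x → x + 2 * m * x) (sum-tabulate (λ k → ∣ A k ∣)) ⟩
    S + 2 * m * S                                      ≤⟨ double-counting-bound m A ⟩
    P + n * (m * suc m)                                ≤⟨ +-monoˡ-≤ (n * (m * suc m)) (∑∑≤∑diagonal (λ k l → ∣ A k ∩ A l ∣) maximal) ⟩
    ∑[ k < 2 + N ] ∣ A k ∩ A k ∣ + G + n * (m * suc m) ≡⟨ cong (λ D → D + G + n * (m * suc m)) (sum-cong-≗ (λ k → cong ∣_∣ (∩-idem (A k)))) ⟩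
    S + G + n * (m * suc m)                            ≡⟨ +-assoc S G _ ⟩
    S + (G + n * (m * suc m))                          ≡⟨ cong (_+ (G + n * (m * suc m))) (sum-tabulate (λ k → ∣ A k ∣)) ⟨
    S′ + (G + n * (m * suc m))                         ∎)
    where
    open ≤-Reasoning
    S′ S P G : ℕ
    S′ = Vec.sum (tabulate (λ k → ∣ A k ∣))
    S = ∑[ k < 2 + N ] ∣ A k ∣
    P = ∑[ k < 2 + N ] ∑[ l < 2 + N ] ∣ A k ∩ A l ∣
    G = (2 + N) * ((1 + N) * ∣ A k ∩ A l ∣)


module Rational where
  open import Data.Nat as ℕ using (suc)
  import Data.Nat.Properties as ℕ
  open import Data.Integer as ℤ using (+_)
  import Data.Integer.Properties as ℤ
  open import Data.Rational using (ℚ; 1ℚ; _+_; _-_; _*_; -_; _≤_; toℚᵘ; NonNegative; Positive)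
  open import Data.Rational.Properties
  open import Data.Rational.Unnormalised as ℚᵘ using (mkℚᵘ; *≡*; *≤*; _≃_)
  import Data.Rational.Unnormalised.Properties as ℚᵘ
  open import Data.Rational.Solver using (module +-*-Solver)
  open import Relation.Binary.PropositionalEquality
  open +-*-Solver using (solve; _:=_; _:+_; _:-_; _:*_; con)

  toℚᵘ-⟦⟧ : ∀ m → toℚᵘ ⟦ m ⟧ ≃ mkℚᵘ (+ m) 0
  toℚᵘ-⟦⟧ m = toℚᵘ-fromℚᵘ (mkℚᵘ (+ m) 0)

  ⟦⟧-homo-+ : ∀ m n → ⟦ m ℕ.+ n ⟧ ≡ ⟦ m ⟧ + ⟦ n ⟧
  ⟦⟧-homo-+ m n = toℚᵘ-injective (begin
    toℚᵘ ⟦ m ℕ.+ n ⟧                ≈⟨ toℚᵘ-⟦⟧ (m ℕ.+ n) ⟩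
    mkℚᵘ (+ (m ℕ.+ n)) 0            ≈⟨ *≡* (cong (ℤ._* + 1) (trans (ℤ.pos-+ m n)
                                         (sym (cong₂ ℤ._+_ (ℤ.*-identityʳ (+ m)) (ℤ.*-identityʳ (+ n)))))) ⟩
    mkℚᵘ (+ m) 0 ℚᵘ.+ mkℚᵘ (+ n) 0  ≈⟨ ℚᵘ.+-cong (toℚᵘ-⟦⟧ m) (toℚᵘ-⟦⟧ n) ⟨
    toℚᵘ ⟦ m ⟧ ℚᵘ.+ toℚᵘ ⟦ n ⟧       ≈⟨ toℚᵘ-homo-+ ⟦ m ⟧ ⟦ n ⟧ ⟨
    toℚᵘ (⟦ m ⟧ + ⟦ n ⟧)            ∎)
    where open ℚᵘ.≃-Reasoning

  ⟦⟧-homo-* : ∀ m n → ⟦ m ℕ.* n ⟧ ≡ ⟦ m ⟧ * ⟦ n ⟧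
  ⟦⟧-homo-* m n = toℚᵘ-injective (begin
    toℚᵘ ⟦ m ℕ.* n ⟧                ≈⟨ toℚᵘ-⟦⟧ (m ℕ.* n) ⟩
    mkℚᵘ (+ (m ℕ.* n)) 0            ≈⟨ *≡* (cong (ℤ._* + 1) (ℤ.pos-* m n)) ⟩
    mkℚᵘ (+ m) 0 ℚᵘ.* mkℚᵘ (+ n) 0  ≈⟨ ℚᵘ.*-cong (toℚᵘ-⟦⟧ m) (toℚᵘ-⟦⟧ n) ⟨
    toℚᵘ ⟦ m ⟧ ℚᵘ.* toℚᵘ ⟦ n ⟧       ≈⟨ toℚᵘ-homo-* ⟦ m ⟧ ⟦ n ⟧ ⟨
    toℚᵘ (⟦ m ⟧ * ⟦ n ⟧)            ∎)
    where open ℚᵘ.≃-Reasoning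

  ⟦⟧-mono-≤ : ∀ {m n} → m ℕ.≤ n → ⟦ m ⟧ ≤ ⟦ n ⟧
  ⟦⟧-mono-≤ {m} {n} m≤n = toℚᵘ-cancel-≤ (ℚᵘ.≤-respˡ-≃ (ℚᵘ.≃-sym (toℚᵘ-⟦⟧ m))
    (ℚᵘ.≤-respʳ-≃ (ℚᵘ.≃-sym (toℚᵘ-⟦⟧ n)) (*≤* (ℤ.*-monoʳ-≤-nonNeg (+ 1) (ℤ.+≤+ m≤n)))))

  recip-inverseˡ : ∀ n .{{_ : ℕ.NonZero n}} → recip n * ⟦ n ⟧ ≡ 1ℚ
  recip-inverseˡ (suc k) = toℚᵘ-injective (begin
    toℚᵘ (recip (suc k) * ⟦ suc k ⟧)            ≈⟨ toℚᵘ-homo-* (recip (suc k)) ⟦ suc k ⟧ ⟩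
    toℚᵘ (recip (suc k)) ℚᵘ.* toℚᵘ ⟦ suc k ⟧     ≈⟨ ℚᵘ.*-cong (toℚᵘ-fromℚᵘ (mkℚᵘ (+ 1) k)) (toℚᵘ-⟦⟧ (suc k)) ⟩
    ℚᵘ.1/ mkℚᵘ (+ suc k) 0 ℚᵘ.* mkℚᵘ (+ suc k) 0  ≈⟨ ℚᵘ.*-inverseˡ (mkℚᵘ (+ suc k) 0) ⟩
    ℚᵘ.1ℚᵘ                                        ∎)
    where open ℚᵘ.≃-Reasoning

  ⟦⟧-homo-∸ : ∀ {m n} → n ℕ.≤ m → ⟦ m ℕ.∸ n ⟧ ≡ ⟦ m ⟧ - ⟦ n ⟧
  ⟦⟧-homo-∸ {m} {n} n≤m = begin
    ⟦ m ℕ.∸ n ⟧                  ≡⟨ solve 2 (λ x y → x := x :+ y :- y) refl ⟦ m ℕ.∸ n ⟧ ⟦ n ⟧ ⟩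
    ⟦ m ℕ.∸ n ⟧ + ⟦ n ⟧ - ⟦ n ⟧  ≡⟨ cong (_- ⟦ n ⟧) (⟦⟧-homo-+ (m ℕ.∸ n) n) ⟨
    ⟦ m ℕ.∸ n ℕ.+ n ⟧ - ⟦ n ⟧    ≡⟨ cong (λ x → ⟦ x ⟧ - ⟦ n ⟧) (ℕ.m∸n+n≡m n≤m) ⟩
    ⟦ m ⟧ - ⟦ n ⟧                ∎
    where open ≡-Reasoning

  -- μ stands for r - 1, and ρ, ι for recip r, recip (r * r * suc r). Multiplying by r² (r + 1)
  -- leaves ρ and ι only in the products ρ r and ι r² (r + 1), which are 1.
  module _ (μ : ℚ) where

    private
      r : ℚ
      r = 1ℚ + μ

    cleared-hypothesis : ∀ {ρ} a n → ρ * r ≡ 1ℚ →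
      r * ((r - ρ - (1ℚ + r) * a) * n) ≡ (r * r - (1ℚ + r) * r * a - 1ℚ) * n
    cleared-hypothesis {ρ} a n ρr≡1 = begin
      r * ((r - ρ - (1ℚ + r) * a) * n)                   ≡⟨ expand μ ρ a n ⟩
      (r * r - (1ℚ + r) * r * a - ρ * r) * n             ≡⟨ cong (λ u → (r * r - (1ℚ + r) * r * a - u) * n) ρr≡1 ⟩
      (r * r - (1ℚ + r) * r * a - 1ℚ) * n                ∎
      where
      open ≡-Reasoning
      expand : ∀ μ ρ a n → let r = 1ℚ + μ in
        r * ((r - ρ - (1ℚ + r) * a) * n) ≡ (r * r - (1ℚ + r) * r * a - ρ * r) * n
      expand = solve 4 (λ μ ρ a n → let r = con 1ℚ :+ μ in
        r :* ((r :- ρ :- (con 1ℚ :+ r) :* a) :* n) := (r :* r :- (con 1ℚ :+ r) :* r :* a :- ρ :* r) :* n) refl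

    cleared-target : ∀ {ρ ι} a n → ρ * r ≡ 1ℚ → ι * (r * r * (1ℚ + r)) ≡ 1ℚ →
      r * r * (1ℚ + r) * (((μ - 1ℚ) * ρ + ⟦ 2 ⟧ * ι - ⟦ 2 ⟧ * μ * ρ * a) * n)
        ≡ ((μ - 1ℚ) * r * (1ℚ + r) - ⟦ 2 ⟧ * μ * r * (1ℚ + r) * a + ⟦ 2 ⟧) * n
    cleared-target {ρ} {ι} a n ρr≡1 ιX≡1 = begin
      r * r * (1ℚ + r) * (((μ - 1ℚ) * ρ + ⟦ 2 ⟧ * ι - ⟦ 2 ⟧ * μ * ρ * a) * n)
        ≡⟨ expand μ ρ ι a n ⟩
      (P * (ρ * r) + ⟦ 2 ⟧ * (ι * (r * r * (1ℚ + r)))) * n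
        ≡⟨ cong₂ (λ u v → (P * u + ⟦ 2 ⟧ * v) * n) ρr≡1 ιX≡1 ⟩
      (P * 1ℚ + ⟦ 2 ⟧ * 1ℚ) * n
        ≡⟨ cong (_* n) (cong₂ _+_ (*-identityʳ P) (*-identityʳ ⟦ 2 ⟧)) ⟩
      (P + ⟦ 2 ⟧) * n ∎
      where
      open ≡-Reasoning
      P : ℚ
      P = (μ - 1ℚ) * r * (1ℚ + r) - ⟦ 2 ⟧ * μ * r * (1ℚ + r) * a
      expand : ∀ μ ρ ι a n → let r = 1ℚ + μ in
        r * r * (1ℚ + r) * (((μ - 1ℚ) * ρ + ⟦ 2 ⟧ * ι - ⟦ 2 ⟧ * μ * ρ * a) * n)
          ≡ (((μ - 1ℚ) * r * (1ℚ + r) - ⟦ 2 ⟧ * μ * r * (1ℚ + r) * a) * (ρ * r) + ⟦ 2 ⟧ * (ι * (r * r * (1ℚ + r)))) * n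
      expand = solve 5 (λ μ ρ ι a n → let o = con 1ℚ ; t = con ⟦ 2 ⟧ ; r = o :+ μ in
        r :* r :* (o :+ r) :* (((μ :- o) :* ρ :+ t :* ι :- t :* μ :* ρ :* a) :* n)
          := (((μ :- o) :* r :* (o :+ r) :- t :* μ :* r :* (o :+ r) :* a) :* (ρ :* r) :+ t :* (ι :* (r :* r :* (o :+ r)))) :* n) refl

    bound-from-counting : .{{_ : NonNegative μ}} → ∀ {ρ ι} a n S G → ρ * r ≡ 1ℚ → ι * (r * r * (1ℚ + r)) ≡ 1ℚ →
      (r - ρ - (1ℚ + r) * a) * n ≤ S →
      ⟦ 2 ⟧ * μ * S ≤ (1ℚ + r) * (r * G) + n * (μ * r) →
      ((μ - 1ℚ) * ρ + ⟦ 2 ⟧ * ι - ⟦ 2 ⟧ * μ * ρ * a) * n ≤ G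
    bound-from-counting {ρ} {ι} a n S G ρr≡1 ιX≡1 hyp counting = *-cancelˡ-≤-pos (r * r * (1ℚ + r)) (begin
      r * r * (1ℚ + r) * (((μ - 1ℚ) * ρ + ⟦ 2 ⟧ * ι - ⟦ 2 ⟧ * μ * ρ * a) * n)
        ≡⟨ cleared-target {ρ} {ι} a n ρr≡1 ιX≡1 ⟩
      ((μ - 1ℚ) * r * (1ℚ + r) - ⟦ 2 ⟧ * μ * r * (1ℚ + r) * a + ⟦ 2 ⟧) * n
        ≡⟨ regroup μ a n ⟩
      ⟦ 2 ⟧ * μ * ((r * r - (1ℚ + r) * r * a - 1ℚ) * n) - r * c
        ≡⟨ cong (λ h → ⟦ 2 ⟧ * μ * h - r * c) (cleared-hypothesis a n ρr≡1) ⟨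
      ⟦ 2 ⟧ * μ * (r * ((r - ρ - (1ℚ + r) * a) * n)) - r * c
        ≤⟨ +-monoˡ-≤ (- (r * c)) (*-monoˡ-≤-nonNeg (⟦ 2 ⟧ * μ) (*-monoˡ-≤-nonNeg r hyp)) ⟩
      ⟦ 2 ⟧ * μ * (r * S) - r * c
        ≡⟨ solve 4 (λ μ S c r → con ⟦ 2 ⟧ :* μ :* (r :* S) :- r :* c := r :* (con ⟦ 2 ⟧ :* μ :* S :- c)) refl μ S c r ⟩
      r * (⟦ 2 ⟧ * μ * S - c)
        ≤⟨ *-monoˡ-≤-nonNeg r (+-monoˡ-≤ (- c) counting) ⟩
      r * ((1ℚ + r) * (r * G) + c - c)
        ≡⟨ solve 3 (λ r G c → r :* ((con 1ℚ :+ r) :* (r :* G) :+ c :- c) := r :* r :* (con 1ℚ :+ r) :* G) refl r G c ⟩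
      r * r * (1ℚ + r) * G ∎)
      where
      open ≤-Reasoning
      c : ℚ
      c = n * (μ * r)
      instance
        r-positive : Positive r
        r-positive = pos+nonNeg⇒pos 1ℚ μ
        X-positive : Positive (r * r * (1ℚ + r))
        X-positive = pos*pos⇒pos (r * r) {{pos*pos⇒pos r r}} (1ℚ + r) {{pos+pos⇒pos 1ℚ r}}
        r-nonNegative : NonNegative r
        r-nonNegative = pos⇒nonNeg r
        2μ-nonNegative : NonNegative (⟦ 2 ⟧ * μ)
        2μ-nonNegative = nonNeg*nonNeg⇒nonNeg ⟦ 2 ⟧ μ
      regroup : ∀ μ a n → let r = 1ℚ + μ in
        ((μ - 1ℚ) * r * (1ℚ + r) - ⟦ 2 ⟧ * μ * r * (1ℚ + r) * a + ⟦ 2 ⟧) * n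
          ≡ ⟦ 2 ⟧ * μ * ((r * r - (1ℚ + r) * r * a - 1ℚ) * n) - r * (n * (μ * r))
      regroup = solve 3 (λ μ a n → let o = con 1ℚ ; t = con ⟦ 2 ⟧ ; r = o :+ μ in
        ((μ :- o) :* r :* (o :+ r) :- t :* μ :* r :* (o :+ r) :* a :+ t) :* n
          := t :* μ :* ((r :* r :- (o :+ r) :* r :* a :- o) :* n) :- r :* (n :* (μ :* r))) refl

open import Data.Nat as ℕ using (ℕ; suc; s≤s)
open import Data.Fin using (Fin)
open import Data.Fin as F using ()
open import Data.Fin.Subset using (Subset; ∣_∣; _∩_)
open import Data.Vec using (sum; tabulate)
open import Data.Product using (∃₂; _×_; _,_)
open import Data.Rational using (ℚ; 0ℚ; 1ℚ; _+_; _-_; _*_; _≤_; _<_)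
open import Data.Rational.Properties using (normalize-nonNeg)
open import Relation.Binary.PropositionalEquality
open Counting using (pair-with-large-intersection)
open Rational

intersection-bound : ∀ m → 1 ℕ.≤ m → ∀ a n S G →
  (⟦ suc m ⟧ - recip (suc m) - ⟦ suc (suc m) ⟧ * a) * ⟦ n ⟧ ≤ ⟦ S ⟧ →
  2 ℕ.* m ℕ.* S ℕ.≤ suc (suc m) ℕ.* (suc m ℕ.* G) ℕ.+ n ℕ.* (m ℕ.* suc m) →
  (⟦ m ℕ.∸ 1 ⟧ * recip (suc m) + ⟦ 2 ⟧ * recip (suc m ℕ.* suc m ℕ.* suc (suc m)) - ⟦ 2 ℕ.* m ⟧ * recip (suc m) * a) * ⟦ n ⟧
    ≤ ⟦ G ⟧
intersection-bound m 1≤m a n S G density counting =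
  subst₂ (λ x y → (x * recip (suc m) + ⟦ 2 ⟧ * recip X - y * recip (suc m) * a) * ⟦ n ⟧ ≤ ⟦ G ⟧)
    (sym (⟦⟧-homo-∸ {m} {1} 1≤m)) (sym (⟦⟧-homo-* 2 m))
    (bound-from-counting μ {{normalize-nonNeg m 1}} {recip (suc m)} {recip X} a ⟦ n ⟧ ⟦ S ⟧ ⟦ G ⟧ ρ-inverse ι-inverse density′ counting′)
  where
  μ : ℚ
  μ = ⟦ m ⟧
  X : ℕ
  X = suc m ℕ.* suc m ℕ.* suc (suc m)
  ⟦1+m⟧ : ⟦ suc m ⟧ ≡ 1ℚ + μ
  ⟦1+m⟧ = ⟦⟧-homo-+ 1 m
  ⟦2+m⟧ : ⟦ suc (suc m) ⟧ ≡ 1ℚ + (1ℚ + μ)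
  ⟦2+m⟧ = trans (⟦⟧-homo-+ 1 (suc m)) (cong (1ℚ +_) ⟦1+m⟧)
  ⟦X⟧ : ⟦ X ⟧ ≡ (1ℚ + μ) * (1ℚ + μ) * (1ℚ + (1ℚ + μ))
  ⟦X⟧ = trans (⟦⟧-homo-* (suc m ℕ.* suc m) (suc (suc m)))
          (cong₂ _*_ (trans (⟦⟧-homo-* (suc m) (suc m)) (cong₂ _*_ ⟦1+m⟧ ⟦1+m⟧)) ⟦2+m⟧)
  ρ-inverse : recip (suc m) * (1ℚ + μ) ≡ 1ℚ
  ρ-inverse = subst (λ x → recip (suc m) * x ≡ 1ℚ) ⟦1+m⟧ (recip-inverseˡ (suc m))
  ι-inverse : recip X * ((1ℚ + μ) * (1ℚ + μ) * (1ℚ + (1ℚ + μ))) ≡ 1ℚ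
  ι-inverse = subst (λ x → recip X * x ≡ 1ℚ) ⟦X⟧ (recip-inverseˡ X)
  density′ : (1ℚ + μ - recip (suc m) - (1ℚ + (1ℚ + μ)) * a) * ⟦ n ⟧ ≤ ⟦ S ⟧
  density′ = subst₂ (λ x y → (x - recip (suc m) - y * a) * ⟦ n ⟧ ≤ ⟦ S ⟧) ⟦1+m⟧ ⟦2+m⟧ density
  counting′ : ⟦ 2 ⟧ * μ * ⟦ S ⟧ ≤ (1ℚ + (1ℚ + μ)) * ((1ℚ + μ) * ⟦ G ⟧) + ⟦ n ⟧ * (μ * (1ℚ + μ))
  counting′ = subst₂ _≤_
    (trans (⟦⟧-homo-* (2 ℕ.* m) S) (cong (_* ⟦ S ⟧) (⟦⟧-homo-* 2 m)))
    (trans (⟦⟧-homo-+ (suc (suc m) ℕ.* (suc m ℕ.* G)) (n ℕ.* (m ℕ.* suc m))) (cong₂ _+_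
      (trans (⟦⟧-homo-* (suc (suc m)) (suc m ℕ.* G)) (cong₂ _*_ ⟦2+m⟧ (trans (⟦⟧-homo-* (suc m) G) (cong (_* ⟦ G ⟧) ⟦1+m⟧))))
      (trans (⟦⟧-homo-* n (m ℕ.* suc m)) (cong (⟦ n ⟧ *_) (trans (⟦⟧-homo-* m (suc m)) (cong (μ *_) ⟦1+m⟧))))))
    (⟦⟧-mono-≤ counting)

lemma4 : (r : ℕ) → 2 ℕ.≤ r → (a : ℚ) → 0ℚ < a → a < recip (r ℕ.* suc r) →
         (n : ℕ) → (A : Fin (suc r) → Subset n) →
         (⟦ r ⟧ - recip r - ⟦ suc r ⟧ * a) * ⟦ n ⟧ ≤ ⟦ sum (tabulate (λ i → ∣ A i ∣)) ⟧ →
         ∃₂ λ (k l : Fin (suc r)) → k F.< l ×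
           (⟦ r ℕ.∸ 2 ⟧ * recip r + ⟦ 2 ⟧ * recip (r ℕ.* r ℕ.* suc r) - ⟦ 2 ℕ.* (r ℕ.∸ 1) ⟧ * recip r * a) * ⟦ n ⟧ ≤ ⟦ ∣ A k ∩ A l ∣ ⟧
lemma4 (suc m) (s≤s 1≤m) a _ _ n A density =
  let k , l , k<l , counting = pair-with-large-intersection m A
  in  k , l , k<l , intersection-bound m 1≤m a n (sum (tabulate (λ i → ∣ A i ∣))) ∣ A k ∩ A l ∣ density counting
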